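{- Let $r=(r_1,\ldots,r_m)$ be a sequence of positive reals and let $h,p,q$ be positive integers. If $m=2^{\sum_{k=0}^{p-1}h^k+\sum_{k=0}^{q-1}h^k}$, then $r$ contains either an $h$-increasing sum-subsequence of length $p$ or an $h$-decreasing sum-subsequence of length $q$.
   Context: For a strictly increasing sequence of indices $\iota=(i_0,\ldots,i_t)$ in $\{0,\ldots,m\}$, the sum-subsequence of $r$ corresponding to $\iota$ is $\left(\sum_{k=i_0+1}^{i_1}r_k,\ldots,\sum_{k=i_{t-1}+1}^{i_t}r_k\right)$ (of length $t$). A real sequence $(s_i)$ is $h$-increasing if $hs_i\le s_{i+1}$ for all $i$ and $h$-decreasing if $s_i\ge hs_{i+1}$ for all $i$. -}

module Defs where

open import Level using (Level; _⊔_; suc)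
open import Data.Nat as ℕ using (ℕ; zero; _^_; _≤ᵇ_; _<ᵇ_)
open import Data.Fin as Fin using (Fin; toℕ; inject₁)
open import Data.Bool using (if_then_else_; _∧_)
open import Data.Product using (_×_)
open import Relation.Binary.Core using (Rel)
open import Relation.Binary.Structures using (IsTotalOrder)
open import Relation.Binary.PropositionalEquality using (_≡_)
open import Relation.Nullary using (¬_)
open import Algebra.Bundles using (CommutativeRing)
import Algebra.Definitions.RawMonoid as RawMonoidDefs

geomSum : ℕ → ℕ → ℕ
geomSum h zero    = 0
geomSum h (ℕ.suc n) = geomSum h n ℕ.+ h ^ n

-- A (totally) ordered commutative ring; the real numbers are an instance.
record OrderedCommutativeRing (c ℓ₁ ℓ₂ : Level) : Set (suc (c ⊔ ℓ₁ ⊔ ℓ₂)) where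
  field
    commutativeRing : CommutativeRing c ℓ₁
  open CommutativeRing commutativeRing public
  field
    _≤_          : Rel Carrier ℓ₂
    isTotalOrder : IsTotalOrder _≈_ _≤_
    +-mono-≤     : ∀ {x y} z → x ≤ y → (x + z) ≤ (y + z)
    *-nonneg     : ∀ {x y} → 0# ≤ x → 0# ≤ y → 0# ≤ (x * y)

  _<_ : Rel Carrier (ℓ₁ ⊔ ℓ₂)
  x < y = (x ≤ y) × ¬ (x ≈ y)

  open RawMonoidDefs +-rawMonoid public using () renaming (_×_ to _·_)

module _ {c ℓ₁ ℓ₂} (R : OrderedCommutativeRing c ℓ₁ ℓ₂) where
  open OrderedCommutativeRing R

  sumFin : ∀ {n} → (Fin n → Carrier) → Carrier
  sumFin {zero}    f = 0#
  sumFin {ℕ.suc n} f = f Fin.zero + sumFin (λ k → f (Fin.suc k))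

  -- For r = (r_1,…,r_m) represented as r : Fin m → Carrier (r (k) = r_{k+1}),
  -- segSum r a b = Σ_{k=a+1}^{b} r_k  (1-based), i.e. the sum of the
  -- 0-based entries with a ≤ k < b.
  segSum : ∀ {m} → (Fin m → Carrier) → ℕ → ℕ → Carrier
  segSum r a b = sumFin (λ k → if (a ≤ᵇ toℕ k) ∧ (toℕ k <ᵇ b) then r k else 0#)

  StrictlyIncreasing : ∀ {t m} → (Fin (ℕ.suc t) → Fin (ℕ.suc m)) → Set
  StrictlyIncreasing ι = ∀ a b → a Fin.< b → ι a Fin.< ι b

  sumSubseq : ∀ {t m} → (Fin m → Carrier) → (Fin (ℕ.suc t) → Fin (ℕ.suc m)) → Fin t → Carrier
  sumSubseq r ι j = segSum r (toℕ (ι (inject₁ j))) (toℕ (ι (Fin.suc j)))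

  HIncreasing : ∀ {t} → ℕ → (Fin t → Carrier) → Set ℓ₂
  HIncreasing h s = ∀ i j → toℕ j ≡ ℕ.suc (toℕ i) → (h · s i) ≤ s j

  HDecreasing : ∀ {t} → ℕ → (Fin t → Carrier) → Set ℓ₂
  HDecreasing h s = ∀ i j → toℕ j ≡ ℕ.suc (toℕ i) → (h · s j) ≤ s i

module Submission where

-- Positions 0,…,m are cut points and seg a b is the weight of [a, b).
-- We search an interval of length 2^n for an increasing and a decreasing
-- chain of cut points at the same time, by halving it.  If the left half is
-- the lighter one, an increasing chain found in the left half is carried
-- over the right half: its last cut point moves to the right end, and as the
-- added stretch outweighs the whole left half, hence every segment of the
-- chain, the ratio between its last two segments rises by one; once that
-- ratio has reached h, a new last segment is appended instead.  A decreasing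
-- chain found in the left half stays valid.  If the right half is lighter,
-- the mirror image happens.  Every halving thus buys one unit of ratio, a
-- complete chain of t+1 segments costs t·h halvings, and so
-- 2^((p-1)h + (q-1)h) ≤ m positions suffice.

open import Defs
open import Data.Nat using (ℕ; suc; _^_; _+_; NonZero)
open import Data.Fin using (Fin)
open import Data.Product using (Σ; _×_)
open import Data.Sum using (_⊎_)
open import Relation.Binary.PropositionalEquality using (_≡_)

open import Level using (0ℓ; _⊔_) renaming (suc to lsuc)
open import Data.Nat as ℕ using (zero; _*_; _∸_; z≤n; s≤s; _≤ᵇ_; _<ᵇ_; s≤s⁻¹)
import Data.Nat.Properties as ℕP
open import Data.Fin as Fin using (toℕ; inject₁; fromℕ<)
import Data.Fin.Properties as FinP
open import Data.Bool using (true; false; T; _∧_; if_then_else_)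
open import Data.Bool.Properties using (T-≡)
open import Data.Empty using (⊥-elim)
open import Data.Product using (_,_; proj₁; proj₂)
import Data.Sum as Sum
open import Function.Bundles using (Equivalence)
open import Relation.Nullary using (¬_; yes; no)
open import Relation.Binary.Core using (Rel)
open import Relation.Binary.Bundles using (Poset)
open import Relation.Binary.Structures using (IsTotalOrder)
open import Relation.Binary.PropositionalEquality as ≡ using (refl; cong; cong₂; subst; subst₂)
import Relation.Binary.Reasoning.PartialOrder as PosetReasoning
import Algebra.Properties.CommutativeSemigroup as CommSemigroupProps

≡false : ∀ {b} → ¬ T b → b ≡ false
≡false {false} _  = refl
≡false {true}  ¬t = ⊥-elim (¬t _)

≤ᵇ-true : ∀ {a x} → a ℕ.≤ x → (a ≤ᵇ x) ≡ true
≤ᵇ-true a≤x = Equivalence.to T-≡ (ℕP.≤⇒≤ᵇ a≤x)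

≤ᵇ-false : ∀ {a x} → x ℕ.< a → (a ≤ᵇ x) ≡ false
≤ᵇ-false {a} {x} x<a = ≡false (λ t → ℕP.<⇒≱ x<a (ℕP.≤ᵇ⇒≤ a x t))

<ᵇ-true : ∀ {x b} → x ℕ.< b → (x <ᵇ b) ≡ true
<ᵇ-true x<b = Equivalence.to T-≡ (ℕP.<⇒<ᵇ x<b)

<ᵇ-false : ∀ {x b} → b ℕ.≤ x → (x <ᵇ b) ≡ false
<ᵇ-false {x} {b} b≤x = ≡false (λ t → ℕP.≤⇒≯ b≤x (ℕP.<ᵇ⇒< x b t))

module OrderedRingFacts {c ℓ₁ ℓ₂} (R : OrderedCommutativeRing c ℓ₁ ℓ₂) where
  open OrderedCommutativeRing R
    renaming (_+_ to _⊕_; refl to ≈-refl; sym to ≈-sym; trans to ≈-trans)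

  poset : Poset c ℓ₁ ℓ₂
  poset = record
    { Carrier = Carrier ; _≈_ = _≈_ ; _≤_ = _≤_
    ; isPartialOrder = IsTotalOrder.isPartialOrder isTotalOrder }

  open PosetReasoning poset public
  open IsTotalOrder isTotalOrder public using (total) renaming (refl to ≤-refl; trans to ≤-trans)

  +-mono-≤₂ : ∀ {a b x y} → a ≤ b → x ≤ y → (a ⊕ x) ≤ (b ⊕ y)
  +-mono-≤₂ {a} {b} {x} {y} a≤b x≤y = begin
    a ⊕ x ≤⟨ +-mono-≤ x a≤b ⟩
    b ⊕ x ≈⟨ +-comm b x ⟩
    x ⊕ b ≤⟨ +-mono-≤ b x≤y ⟩
    y ⊕ b ≈⟨ +-comm y b ⟩
    b ⊕ y ∎

  x≤x+y : ∀ {x y} → 0# ≤ y → x ≤ (x ⊕ y)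
  x≤x+y {x} {y} 0≤y = begin
    x      ≈⟨ +-identityʳ x ⟨
    x ⊕ 0# ≤⟨ +-mono-≤₂ ≤-refl 0≤y ⟩
    x ⊕ y  ∎

  x≤y+x : ∀ {x y} → 0# ≤ y → x ≤ (y ⊕ x)
  x≤y+x {x} {y} 0≤y = begin
    x      ≈⟨ +-identityˡ x ⟨
    0# ⊕ x ≤⟨ +-mono-≤₂ 0≤y ≤-refl ⟩
    y ⊕ x  ∎

  +-nonneg : ∀ {x y} → 0# ≤ x → 0# ≤ y → 0# ≤ (x ⊕ y)
  +-nonneg {x} 0≤x 0≤y = ≤-trans 0≤x (x≤x+y 0≤y)

  -- One more multiple: since (1+n)·s = s + n·s, the bounds n·s ≤ t and
  -- s ≤ u give (1+n)·s ≤ u + t.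
  ·-suc-≤ : ∀ n {s t u} → (n · s) ≤ t → s ≤ u → (suc n · s) ≤ (u ⊕ t)
  ·-suc-≤ n ns≤t s≤u = +-mono-≤₂ s≤u ns≤t

  1·-≤ : ∀ {s t} → s ≤ t → (1 · s) ≤ t
  1·-≤ {s} {t} s≤t = begin
    1 · s ≈⟨ +-identityʳ s ⟩
    s     ≤⟨ s≤t ⟩
    t     ∎

  sumFin-cong : ∀ {n} {f g : Fin n → Carrier} → (∀ k → f k ≈ g k) → sumFin R f ≈ sumFin R g
  sumFin-cong {zero}  f≈g = ≈-refl
  sumFin-cong {suc n} f≈g = +-cong (f≈g Fin.zero) (sumFin-cong (λ k → f≈g (Fin.suc k)))

  sumFin-+ : ∀ {n} (f g : Fin n → Carrier) →
             sumFin R (λ k → f k ⊕ g k) ≈ (sumFin R f ⊕ sumFin R g)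
  sumFin-+ {zero}  f g = ≈-sym (+-identityʳ 0#)
  sumFin-+ {suc n} f g = ≈-trans
    (+-cong ≈-refl (sumFin-+ (λ k → f (Fin.suc k)) (λ k → g (Fin.suc k))))
    (CommSemigroupProps.interchange +-commutativeSemigroup (f Fin.zero) (g Fin.zero) _ _)

  sumFin-nonneg : ∀ {n} {f : Fin n → Carrier} → (∀ k → 0# ≤ f k) → 0# ≤ sumFin R f
  sumFin-nonneg {zero}  f≥0 = ≤-refl
  sumFin-nonneg {suc n} f≥0 = +-nonneg (f≥0 Fin.zero) (sumFin-nonneg (λ k → f≥0 (Fin.suc k)))

-- Increasing and decreasing sum-subsequences are chains for the two
-- directions of ℕ, with D the segment sum read forwards or backwards.
record Direction {c ℓ₁ ℓ₂} (R : OrderedCommutativeRing c ℓ₁ ℓ₂) : Set (c ⊔ ℓ₁ ⊔ ℓ₂ ⊔ lsuc 0ℓ) where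
  open OrderedCommutativeRing R using (Carrier; _≈_; _≤_; 0#) renaming (_+_ to _⊕_)
  field
    _≼_ _≺_   : Rel ℕ 0ℓ
    ≼-refl    : ∀ {x} → x ≼ x
    ≼-trans   : ∀ {x y z} → x ≼ y → y ≼ z → x ≼ z
    ≺⇒≼       : ∀ {x y} → x ≺ y → x ≼ y
    ≼-≺-trans : ∀ {x y z} → x ≼ y → y ≺ z → x ≺ z
    ≺-≼-trans : ∀ {x y z} → x ≺ y → y ≼ z → x ≺ z
    D         : ℕ → ℕ → Carrier
    D-split   : ∀ {x y z} → x ≼ y → y ≼ z → (D x y ⊕ D y z) ≈ D x z
    D-nonneg  : ∀ x y → 0# ≤ D x y

module Segments {c ℓ₁ ℓ₂} (R : OrderedCommutativeRing c ℓ₁ ℓ₂) {m : ℕ}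
  (r : Fin m → OrderedCommutativeRing.Carrier R)
  (r≥0 : ∀ k → OrderedCommutativeRing._≤_ R (OrderedCommutativeRing.0# R) (r k)) where
  open OrderedCommutativeRing R
    renaming (_+_ to _⊕_; refl to ≈-refl; sym to ≈-sym; trans to ≈-trans)
  open OrderedRingFacts R

  seg : ℕ → ℕ → Carrier
  seg = segSum R r

  summand : ℕ → ℕ → Fin m → Carrier
  summand a b k = if (a ≤ᵇ toℕ k) ∧ (toℕ k <ᵇ b) then r k else 0#

  -- For a ≤ b ≤ d a summand of seg a d is the sum of the corresponding
  -- summands of seg a b and seg b d: at most one of their tests holds.
  summand-split : ∀ {a b d} k → a ℕ.≤ b → b ℕ.≤ d →
                  summand a d k ≈ (summand a b k ⊕ summand b d k)
  summand-split {a} {b} {d} k a≤b b≤d with toℕ k ℕ.<? b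
  ... | yes k<b rewrite <ᵇ-true k<b | <ᵇ-true (ℕP.<-≤-trans k<b b≤d) | ≤ᵇ-false k<b =
    ≈-sym (+-identityʳ _)
  ... | no k≮b rewrite ≤ᵇ-true (ℕP.≤-trans a≤b (ℕP.≮⇒≥ k≮b)) | <ᵇ-false (ℕP.≮⇒≥ k≮b)
                     | ≤ᵇ-true (ℕP.≮⇒≥ k≮b) =
    ≈-sym (+-identityˡ _)

  seg-split : ∀ {a b d} → a ℕ.≤ b → b ℕ.≤ d → (seg a b ⊕ seg b d) ≈ seg a d
  seg-split {a} {b} {d} a≤b b≤d = ≈-sym (≈-trans
    (sumFin-cong (λ k → summand-split k a≤b b≤d))
    (sumFin-+ (summand a b) (summand b d)))

  seg-nonneg : ∀ a b → 0# ≤ seg a b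
  seg-nonneg a b = sumFin-nonneg (λ k → summand-nonneg ((a ≤ᵇ toℕ k) ∧ (toℕ k <ᵇ b)) (r≥0 k))
    where
      summand-nonneg : ∀ test {v} → 0# ≤ v → 0# ≤ (if test then v else 0#)
      summand-nonneg true  0≤v = 0≤v
      summand-nonneg false _   = ≤-refl

  ascending : Direction R
  ascending = record
    { _≼_ = ℕ._≤_ ; _≺_ = ℕ._<_
    ; ≼-refl = ℕP.≤-refl ; ≼-trans = ℕP.≤-trans ; ≺⇒≼ = ℕP.<⇒≤
    ; ≼-≺-trans = ℕP.≤-<-trans ; ≺-≼-trans = ℕP.<-≤-trans
    ; D = seg ; D-split = seg-split ; D-nonneg = seg-nonneg }

  descending : Direction R
  descending = record
    { _≼_ = λ x y → y ℕ.≤ x ; _≺_ = λ x y → y ℕ.< x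
    ; ≼-refl = ℕP.≤-refl ; ≼-trans = λ y≤x z≤y → ℕP.≤-trans z≤y y≤x ; ≺⇒≼ = ℕP.<⇒≤
    ; ≼-≺-trans = λ y≤x z<y → ℕP.<-≤-trans z<y y≤x
    ; ≺-≼-trans = λ y<x z≤y → ℕP.≤-<-trans z≤y y<x
    ; D = λ x y → seg y x
    ; D-split = λ y≤x z≤y → ≈-trans (+-comm _ _) (seg-split z≤y y≤x)
    ; D-nonneg = λ x y → seg-nonneg y x }

module Chains {c ℓ₁ ℓ₂} {R : OrderedCommutativeRing c ℓ₁ ℓ₂} (dir : Direction R) (h : ℕ) where
  open OrderedCommutativeRing R using (Carrier; _≤_; _·_) renaming (_+_ to _⊕_)
  open OrderedRingFacts R
  open Direction dir

  -- Chain k ρ x y l: cut points x = p₀ ≺ y = p₁ ≺ … ≺ p_k = l whose segments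
  -- s_j = D p_j p_(j+1) satisfy ρ·s₁ ≤ s₀ and h·s_(j+1) ≤ s_j for j ≥ 1.
  -- The first ratio ρ is the one still under construction.
  data Chain : ℕ → ℕ → ℕ → ℕ → ℕ → Set ℓ₂ where
    last : ∀ {ρ x y} → x ≺ y → Chain 1 ρ x y y
    step : ∀ {k ρ x y z l} → x ≺ y → (ρ · D y z) ≤ D x y → Chain k h y z l →
           Chain (suc k) ρ x y l

  -- the j-th cut point (constant = l beyond the end)
  point : ∀ {k ρ x y l} → Chain k ρ x y l → ℕ → ℕ
  point {x = x} _ zero    = x
  point (last {y = y} _) (suc _) = y
  point (step _ _ ch)    (suc j) = point ch j

  point-step : ∀ {k ρ x y l} (ch : Chain k ρ x y l) {j} → j ℕ.< k →
               point ch j ≺ point ch (suc j)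
  point-step (last x≺y)     {zero}  _          = x≺y
  point-step (last _)       {suc j} (s≤s ())
  point-step (step x≺y _ _) {zero}  _          = x≺y
  point-step (step _ _ ch)  {suc j} (s≤s j<k) = point-step ch j<k

  point-mono : ∀ {k ρ x y l} (ch : Chain k ρ x y l) {i j} → i ℕ.≤ j →
               point ch i ≼ point ch j
  point-mono _              {zero}  {zero}  _         = ≼-refl
  point-mono (last x≺y)     {zero}  {suc j} _         = ≺⇒≼ x≺y
  point-mono (last _)       {suc i} {suc j} _         = ≼-refl
  point-mono (step x≺y _ ch) {zero} {suc j} _         = ≼-trans (≺⇒≼ x≺y) (point-mono ch {j = j} z≤n)
  point-mono (step _ _ ch)  {suc i} {suc j} (s≤s i≤j) = point-mono ch i≤j

  point-end : ∀ {k ρ x y l} (ch : Chain k ρ x y l) j → point ch j ≼ l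
  point-end (last x≺y)      zero    = ≺⇒≼ x≺y
  point-end (last _)        (suc j) = ≼-refl
  point-end (step x≺y _ ch) zero    = ≼-trans (≺⇒≼ x≺y) (point-end ch zero)
  point-end (step _ _ ch)   (suc j) = point-end ch j

  point-ratio : ∀ {k x y l} (ch : Chain k h x y l) {j} → suc j ℕ.< k →
    (h · D (point ch (suc j)) (point ch (suc (suc j)))) ≤ D (point ch j) (point ch (suc j))
  point-ratio (last _)                   {j}     (s≤s ())
  point-ratio (step _ ratio (last _))    {zero}  _ = ratio
  point-ratio (step _ ratio (step _ _ _)) {zero} _ = ratio
  point-ratio (step _ _ ch)              {suc j} (s≤s j<k) = point-ratio ch j<k

  head≺second : ∀ {k ρ x y l} → Chain k ρ x y l → x ≺ y
  head≺second (last x≺y)     = x≺y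
  head≺second (step x≺y _ _) = x≺y

  second≼end : ∀ {k ρ x y l} → Chain k ρ x y l → y ≼ l
  second≼end (last _)      = ≼-refl
  second≼end (step _ _ ch) = point-end ch zero

  D-mono : ∀ {a x y d} → a ≼ x → x ≼ y → y ≼ d → D x y ≤ D a d
  D-mono {a} {x} {y} {d} a≼x x≼y y≼d = begin
    D x y         ≤⟨ x≤y+x (D-nonneg a x) ⟩
    D a x ⊕ D x y ≈⟨ D-split a≼x x≼y ⟩
    D a y         ≤⟨ x≤x+y (D-nonneg y d) ⟩
    D a y ⊕ D y d ≈⟨ D-split (≼-trans a≼x x≼y) y≼d ⟩
    D a d         ∎

  outweighed : ∀ {z b x u v e} → z ≼ b → b ≼ x → x ≼ u → u ≼ v → v ≼ e →
               D b e ≤ D z b → D u v ≤ D z x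
  outweighed {z} {b} {x} {u} {v} {e} z≼b b≼x x≼u u≼v v≼e heavier = begin
    D u v ≤⟨ D-mono (≼-trans b≼x x≼u) u≼v v≼e ⟩
    D b e ≤⟨ heavier ⟩
    D z b ≤⟨ D-mono ≼-refl z≼b b≼x ⟩
    D z x ∎

  record Span (b e k ρ : ℕ) : Set ℓ₂ where
    constructor span
    field
      first second end : ℕ
      from  : b ≼ first
      to    : end ≼ e
      chain : Chain k ρ first second end

  single : ∀ {b e ρ} → b ≺ e → Span b e 1 ρ
  single b≺e = span _ _ _ ≼-refl ≼-refl (last b≺e)

  widen : ∀ {b e b′ e′ k ρ} → b′ ≼ b → e ≼ e′ → Span b e k ρ → Span b′ e′ k ρ
  widen b′≼b e≼e′ (span x y l b≼x l≼e ch) = span x y l (≼-trans b′≼b b≼x) (≼-trans l≼e e≼e′) ch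

  grow : ∀ {z b e k ρ} → z ≼ b → D b e ≤ D z b → Span b e k ρ → Span z e k (suc ρ)
  grow z≼b heavier (span x y l b≼x l≼e (last x≺y)) =    -- a single segment has no ratio
    span _ y l ≼-refl l≼e (last (≼-≺-trans (≼-trans z≼b b≼x) x≺y))
  grow {z} {ρ = ρ} z≼b heavier (span x y l b≼x l≼e (step {z = w} x≺y ratio ch)) =
    span z y l ≼-refl l≼e (step (≼-≺-trans z≼x x≺y) raised ch)
    where
      z≼x : z ≼ x
      z≼x = ≼-trans z≼b b≼x
      raised : (suc ρ · D y w) ≤ D z y
      raised = begin
        suc ρ · D y w ≤⟨ ·-suc-≤ ρ ratio (outweighed z≼b b≼x (≺⇒≼ x≺y) (≺⇒≼ (head≺second ch))
                                              (≼-trans (second≼end ch) l≼e) heavier) ⟩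
        D z x ⊕ D x y ≈⟨ D-split z≼x (≺⇒≼ x≺y) ⟩
        D z y         ∎

  extend : ∀ {z b e k} → z ≺ b → D b e ≤ D z b → Span b e k h → Span z e (suc k) 1
  extend {z} z≺b heavier (span x y l b≼x l≼e ch) =
    span z x l ≼-refl l≼e (step (≺-≼-trans z≺b b≼x) (1·-≤ dominated) ch)
    where
      dominated : D x y ≤ D z x
      dominated = outweighed (≺⇒≼ z≺b) b≼x ≼-refl (≺⇒≼ (head≺second ch))
                             (≼-trans (second≼end ch) l≼e) heavier

  module _ {b e k ρ} (sp : Span b e k ρ) where
    open Span sp

    points : ℕ → ℕ
    points = point chain

    segment : ℕ → Carrier
    segment j = D (points j) (points (suc j))

    points-within : ∀ j → b ≼ points j × points j ≼ e
    points-within j = ≼-trans from (point-mono chain {j = j} z≤n) , ≼-trans (point-end chain j) to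

    points-strict : ∀ {i j} → i ℕ.< j → i ℕ.< k → points i ≺ points j
    points-strict i<j i<k = ≺-≼-trans (point-step chain i<k) (point-mono chain i<j)

  segment-ratio : ∀ {b e k} (sp : Span b e k h) {j} → suc j ℕ.< k →
                  (h · segment sp (suc j)) ≤ segment sp j
  segment-ratio sp = point-ratio (Span.chain sp)

*≤geomSum : ∀ h′ t → t * suc h′ ℕ.≤ geomSum (suc h′) (suc t)
*≤geomSum h′ zero    = z≤n
*≤geomSum h′ (suc t) = ℕP.≤-trans (ℕP.+-mono-≤ h≤h^[1+t] (*≤geomSum h′ t))
                                  (ℕP.≤-reflexive (ℕP.+-comm _ (geomSum (suc h′) (suc t))))
  where
    h≤h^[1+t] : suc h′ ℕ.≤ suc h′ ^ suc t
    h≤h^[1+t] = subst (ℕ._≤ suc h′ ^ suc t) (ℕP.*-identityʳ (suc h′))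
                      (ℕP.*-monoʳ-≤ (suc h′) (ℕP.m^n>0 (suc h′) t))

-- The goal
-- (t , κ) asks for a chain of t+1 segments whose first ratio is 1+κ; its
-- cost is the number of halvings that suffice to reach it.
module Goals (h′ : ℕ) where
  Goal : Set
  Goal = ℕ × ℕ

  cost : Goal → ℕ
  cost (zero  , κ) = 0
  cost (suc t , κ) = suc κ + t * suc h′

  -- the goal that one halving step reduces (suc t , κ) to: a smaller first
  -- ratio, or, when the first ratio is 1, one segment less with full ratio h
  prev : ℕ → ℕ → Goal
  prev t (suc κ) = suc t , κ
  prev t zero    = t , h′

  cost-prev : ∀ t κ → suc (cost (prev t κ)) ≡ cost (suc t , κ)
  cost-prev t       (suc κ) = refl
  cost-prev zero    zero    = refl
  cost-prev (suc t) zero    = refl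

  cost-complete : ∀ t → cost (t , h′) ≡ t * suc h′
  cost-complete zero    = refl
  cost-complete (suc t) = refl

  cost≤geomSum : ∀ t → cost (t , h′) ℕ.≤ geomSum (suc h′) (suc t)
  cost≤geomSum t = subst (ℕ._≤ geomSum (suc h′) (suc t)) (≡.sym (cost-complete t)) (*≤geomSum h′ t)

module Reaching {c ℓ₁ ℓ₂} {R : OrderedCommutativeRing c ℓ₁ ℓ₂} (dir : Direction R) (h′ : ℕ) where
  open OrderedCommutativeRing R using (_≤_)
  open Direction dir
  open Goals h′
  open Chains dir (suc h′) public

  Reach : ℕ → ℕ → Goal → Set ℓ₂
  Reach b e g = Span b e (suc (proj₁ g)) (suc (proj₂ g))

  advance : ∀ {z b e} t κ → z ≺ b → D b e ≤ D z b → Reach b e (prev t κ) → Reach z e (suc t , κ)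
  advance t (suc κ) z≺b heavier = grow (≺⇒≼ z≺b) heavier
  advance t zero    z≺b heavier = extend z≺b heavier

module Halving {c ℓ₁ ℓ₂} (R : OrderedCommutativeRing c ℓ₁ ℓ₂) {m : ℕ}
  (r : Fin m → OrderedCommutativeRing.Carrier R)
  (r≥0 : ∀ k → OrderedCommutativeRing._≤_ R (OrderedCommutativeRing.0# R) (r k))
  (h′ : ℕ) where
  open OrderedCommutativeRing R using (_≤_)
  open OrderedRingFacts R using (total)
  open Segments R r r≥0 public
  open Goals h′ public
  module Inc = Reaching descending h′
  module Dec = Reaching ascending h′

  -- Chains inside [lo, hi].  An increasing chain is extended at its right
  -- end, so it is built as a descending span from hi down to lo.
  IncIn DecIn : ℕ → ℕ → Goal → Set ℓ₂
  IncIn lo hi = Inc.Reach hi lo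
  DecIn lo hi = Dec.Reach lo hi

  lo<lo+2^n : ∀ lo n → lo ℕ.< lo + 2 ^ n
  lo<lo+2^n lo n = ℕP.m<m+n lo (ℕP.m^n>0 2 n)

  halves : ∀ lo n → lo + 2 ^ suc n ≡ (lo + 2 ^ n) + 2 ^ n
  halves lo n = ≡.trans (cong (λ x → lo + (2 ^ n + x)) (ℕP.+-identityʳ (2 ^ n)))
                        (≡.sym (ℕP.+-assoc lo (2 ^ n) (2 ^ n)))

  -- Split it into halves of length 2^(n-1) at mid: if the left half is
  -- lighter, recurse on it with the increasing goal reduced and advance the
  -- increasing chain across the right half; otherwise mirror this.
  main : ∀ n lo hi gi gd → cost gi + cost gd ℕ.≤ n → lo + 2 ^ n ℕ.≤ hi →
         IncIn lo hi gi ⊎ DecIn lo hi gd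
  main n lo hi (zero , κ) gd _ room =
    Sum.inj₁ (Inc.single (ℕP.<-≤-trans (lo<lo+2^n lo n) room))
  main n lo hi (suc t , κ) (zero , κ′) _ room =
    Sum.inj₂ (Dec.single (ℕP.<-≤-trans (lo<lo+2^n lo n) room))
  main zero    lo hi (suc t , κ) (suc s , κ′) () room
  main (suc n) lo hi (suc t , κ) (suc s , κ′) budget room =
    Sum.[ left-lighter , right-lighter ]′ (total (seg lo mid) (seg mid hi))
    where
      mid : ℕ
      mid = lo + 2 ^ n

      room-right : mid + 2 ^ n ℕ.≤ hi
      room-right = subst (ℕ._≤ hi) (halves lo n) room

      mid<hi : mid ℕ.< hi
      mid<hi = ℕP.<-≤-trans (lo<lo+2^n mid n) room-right

      budget-left : cost (prev t κ) + cost (suc s , κ′) ℕ.≤ n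
      budget-left = s≤s⁻¹ (subst (λ x → x + cost (suc s , κ′) ℕ.≤ suc n)
                                 (≡.sym (cost-prev t κ)) budget)

      budget-right : cost (suc t , κ) + cost (prev s κ′) ℕ.≤ n
      budget-right = s≤s⁻¹ (subst (ℕ._≤ suc n)
        (≡.trans (cong (cost (suc t , κ) +_) (≡.sym (cost-prev s κ′)))
                 (ℕP.+-suc (cost (suc t , κ)) (cost (prev s κ′))))
        budget)

      left-lighter : seg lo mid ≤ seg mid hi →
                     IncIn lo hi (suc t , κ) ⊎ DecIn lo hi (suc s , κ′)
      left-lighter lighter = Sum.map (Inc.advance t κ mid<hi lighter)
                                     (Dec.widen ℕP.≤-refl (ℕP.<⇒≤ mid<hi))
                                     (main n lo mid (prev t κ) (suc s , κ′) budget-left ℕP.≤-refl)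

      right-lighter : seg mid hi ≤ seg lo mid →
                      IncIn lo hi (suc t , κ) ⊎ DecIn lo hi (suc s , κ′)
      right-lighter lighter = Sum.map (Inc.widen ℕP.≤-refl (ℕP.<⇒≤ (lo<lo+2^n lo n)))
                                      (Dec.advance s κ′ (lo<lo+2^n lo n) lighter)
                                      (main n mid hi (suc t , κ) (prev s κ′) budget-right room-right)

∸-suc : ∀ {i k} → i ℕ.< k → k ∸ i ≡ suc (k ∸ suc i)
∸-suc i<k = ℕP.+-∸-assoc 1 i<k

module Extraction {c ℓ₁ ℓ₂} (R : OrderedCommutativeRing c ℓ₁ ℓ₂) {m : ℕ}
  (r : Fin m → OrderedCommutativeRing.Carrier R)
  (r≥0 : ∀ k → OrderedCommutativeRing._≤_ R (OrderedCommutativeRing.0# R) (r k))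
  (h′ : ℕ) where
  open OrderedCommutativeRing R using (_·_)
  open OrderedRingFacts R
  open Halving R r r≥0 h′ public

  embed : ∀ {k} (f : Fin (suc k) → ℕ) → (∀ a → f a ℕ.≤ m) → Fin (suc k) → Fin (suc m)
  embed f f≤m a = fromℕ< (s≤s (f≤m a))

  module _ {k} (f : Fin (suc k) → ℕ) (f≤m : ∀ a → f a ℕ.≤ m) where
    toℕ-embed : ∀ a → toℕ (embed f f≤m a) ≡ f a
    toℕ-embed a = FinP.toℕ-fromℕ< (s≤s (f≤m a))

    embed-increasing : (∀ {a b} → a Fin.< b → f a ℕ.< f b) → StrictlyIncreasing R (embed f f≤m)
    embed-increasing f-inc a b a<b =
      subst₂ ℕ._<_ (≡.sym (toℕ-embed a)) (≡.sym (toℕ-embed b)) (f-inc a<b)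

    sumSubseq-embed : ∀ i → sumSubseq R r (embed f f≤m) i ≡ seg (f (inject₁ i)) (f (Fin.suc i))
    sumSubseq-embed i = cong₂ seg (toℕ-embed (inject₁ i)) (toℕ-embed (Fin.suc i))

  decreasing : ∀ {t} → DecIn 0 m (t , h′) →
    Σ (Fin (suc (suc t)) → Fin (suc m)) λ ι →
      StrictlyIncreasing R ι × HDecreasing R (suc h′) (sumSubseq R r ι)
  decreasing {t} sp = ι , embed-increasing f f≤m f-increasing , ratio
    where
      f : Fin (suc (suc t)) → ℕ
      f a = Dec.points sp (toℕ a)

      f≤m : ∀ a → f a ℕ.≤ m
      f≤m a = proj₂ (Dec.points-within sp (toℕ a))

      ι : Fin (suc (suc t)) → Fin (suc m)
      ι = embed f f≤m

      f-increasing : ∀ {a b} → a Fin.< b → f a ℕ.< f b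
      f-increasing {a} {b} a<b = Dec.points-strict sp a<b (ℕP.<-≤-trans a<b (s≤s⁻¹ (FinP.toℕ<n b)))

      segment-at : ∀ i → sumSubseq R r ι i ≡ Dec.segment sp (toℕ i)
      segment-at i = ≡.trans (sumSubseq-embed f f≤m i)
        (cong (λ x → seg (Dec.points sp x) (Dec.points sp (suc (toℕ i)))) (FinP.toℕ-inject₁ i))

      ratio : HDecreasing R (suc h′) (sumSubseq R r ι)
      ratio i j j≡1+i = begin
        suc h′ · sumSubseq R r ι j            ≡⟨ cong (suc h′ ·_) (segment-at j) ⟩
        suc h′ · Dec.segment sp (toℕ j)       ≡⟨ cong (λ x → suc h′ · Dec.segment sp x) j≡1+i ⟩
        suc h′ · Dec.segment sp (suc (toℕ i)) ≤⟨ Dec.segment-ratio sp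
                                                   (subst (ℕ._< suc t) j≡1+i (FinP.toℕ<n j)) ⟩
        Dec.segment sp (toℕ i)                ≡⟨ segment-at i ⟨
        sumSubseq R r ι i                     ∎

  -- An increasing span was built from the right end: ι a = p_(k-a).
  increasing : ∀ {t} → IncIn 0 m (t , h′) →
    Σ (Fin (suc (suc t)) → Fin (suc m)) λ ι →
      StrictlyIncreasing R ι × HIncreasing R (suc h′) (sumSubseq R r ι)
  increasing {t} sp = ι , embed-increasing f f≤m f-increasing , ratio
    where
      k : ℕ
      k = suc t

      f : Fin (suc k) → ℕ
      f a = Inc.points sp (k ∸ toℕ a)

      f≤m : ∀ a → f a ℕ.≤ m
      f≤m a = proj₁ (Inc.points-within sp (k ∸ toℕ a))

      ι : Fin (suc (suc t)) → Fin (suc m)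
      ι = embed f f≤m

      f-increasing : ∀ {a b} → a Fin.< b → f a ℕ.< f b
      f-increasing {a} {b} a<b =
        Inc.points-strict sp reversed (ℕP.<-≤-trans reversed (ℕP.m∸n≤m k (toℕ a)))
        where
          reversed : k ∸ toℕ b ℕ.< k ∸ toℕ a
          reversed = ℕP.∸-monoʳ-< a<b (s≤s⁻¹ (FinP.toℕ<n b))

      segment-at : ∀ i → sumSubseq R r ι i ≡ Inc.segment sp (k ∸ suc (toℕ i))
      segment-at i = ≡.trans (sumSubseq-embed f f≤m i)
        (cong (λ x → seg (Inc.points sp x) (Inc.points sp (k ∸ suc (toℕ i))))
              (≡.trans (cong (k ∸_) (FinP.toℕ-inject₁ i)) (∸-suc (FinP.toℕ<n i))))

      ratio : HIncreasing R (suc h′) (sumSubseq R r ι)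
      ratio i j j≡1+i = begin
        suc h′ · sumSubseq R r ι i                        ≡⟨ cong (suc h′ ·_) (segment-at i) ⟩
        suc h′ · Inc.segment sp (k ∸ suc (toℕ i))         ≡⟨ cong (λ x → suc h′ · Inc.segment sp (k ∸ x)) j≡1+i ⟨
        suc h′ · Inc.segment sp (k ∸ toℕ j)               ≡⟨ cong (λ x → suc h′ · Inc.segment sp x) k∸j-unfold ⟩
        suc h′ · Inc.segment sp (suc (k ∸ suc (toℕ j)))   ≤⟨ Inc.segment-ratio sp
                                                               (subst (ℕ._< k) k∸j-unfold k∸j<k) ⟩
        Inc.segment sp (k ∸ suc (toℕ j))                  ≡⟨ segment-at j ⟨
        sumSubseq R r ι j                                 ∎
        where
          k∸j-unfold : k ∸ toℕ j ≡ suc (k ∸ suc (toℕ j))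
          k∸j-unfold = ∸-suc (FinP.toℕ<n j)
          k∸j<k : k ∸ toℕ j ℕ.< k
          k∸j<k = ℕP.∸-monoʳ-< (subst (0 ℕ.<_) (≡.sym j≡1+i) (s≤s z≤n)) (ℕP.<⇒≤ (FinP.toℕ<n j))

lemma5p1 : ∀ {c ℓ₁ ℓ₂} (R : OrderedCommutativeRing c ℓ₁ ℓ₂) →
    (m : ℕ) (r : Fin m → OrderedCommutativeRing.Carrier R) →
    (∀ k → OrderedCommutativeRing._<_ R (OrderedCommutativeRing.0# R) (r k)) →
    (h p q : ℕ) → NonZero h → NonZero p → NonZero q →
    m ≡ 2 ^ (geomSum h p + geomSum h q) →
    (Σ (Fin (suc p) → Fin (suc m)) λ ι →
        StrictlyIncreasing R ι × HIncreasing R h (sumSubseq R r ι))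
    ⊎
    (Σ (Fin (suc q) → Fin (suc m)) λ ι →
        StrictlyIncreasing R ι × HDecreasing R h (sumSubseq R r ι))
lemma5p1 R m r r>0 zero     p       q       (record { nonZero = () }) _ _ _
lemma5p1 R m r r>0 (suc h′) zero    q       _ (record { nonZero = () }) _ _
lemma5p1 R m r r>0 (suc h′) (suc t) zero    _ _ (record { nonZero = () }) _
lemma5p1 R m r r>0 (suc h′) (suc t) (suc s) _ _ _ m≡2^[…] =
  Sum.map increasing decreasing (main n 0 m (t , h′) (s , h′) ℕP.≤-refl room)
  where
    open Extraction R r (λ k → proj₁ (r>0 k)) h′

    n : ℕ
    n = cost (t , h′) + cost (s , h′)

    room : 0 + 2 ^ n ℕ.≤ m
    room = subst (2 ^ n ℕ.≤_) (≡.sym m≡2^[…])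
                 (ℕP.^-monoʳ-≤ 2 (ℕP.+-mono-≤ (cost≤geomSum t) (cost≤geomSum s)))
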